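{- For nonnegative integers $a_1,\dots,a_n$ let $h(a_1,\dots,a_n)=\sum_{x_1=1}^{a_1}\sum_{x_2=1}^{a_2x_1}\cdots\sum_{x_n=1}^{a_nx_{n-1}}1$, and for a positive integer $m$ let $$\mathcal{H}_m(a_1,\dots,a_n)=\sum_{\sigma\in S_n}\operatorname{sign}(\sigma)\,h(m\,a_{\sigma(1)},a_{\sigma(2)},\dots,a_{\sigma(n)}).$$ Then $$\mathcal{H}_m(a_1,\dots,a_n)=\frac{m^n}{n!}\prod_{i=1}^n a_i\prod_{1\le i<j\le n}(a_i-a_j).$$ -}

module Defs where

open import Data.Nat as ℕ using (ℕ; zero; suc)
open import Data.Integer as ℤ using (ℤ; +_; -_)
open import Data.Fin as Fin using (Fin)
open import Data.Fin.Properties as FinP using ()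
open import Data.List as List using (List; []; _∷_; map; concatMap; filter; allFin; foldr; length)
open import Data.List.Relation.Unary.All using (All; all?)
open import Data.Product using (_×_; _,_; proj₁; proj₂)
open import Relation.Nullary using (¬?)
open import Relation.Binary.PropositionalEquality using (_≢_)

sumFrom1 : ℕ → (ℕ → ℕ) → ℕ
sumFrom1 zero    f = 0
sumFrom1 (suc k) f = sumFrom1 k f ℕ.+ f (suc k)

-- hAux x [c₁,…,c_r] = Σ_{y₁=1}^{c₁ x} Σ_{y₂=1}^{c₂ y₁} ⋯ Σ_{y_r=1}^{c_r y_{r-1}} 1
hAux : ℕ → List ℕ → ℕ
hAux x []       = 1
hAux x (c ∷ cs) = sumFrom1 (c ℕ.* x) (λ y → hAux y cs)

h : ∀ {n} → (Fin n → ℕ) → ℕ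
h {n} a = hAux 1 (List.tabulate a)

pairs : ∀ n → List (Fin n × Fin n)
pairs n = concatMap (λ j → map (λ i → (i , j)) (filter (Fin._<? j) (allFin n))) (allFin n)

allFuns : ∀ n k → List (Fin n → Fin k)
allFuns zero    k = (λ ()) ∷ []
allFuns (suc n) k =
  concatMap (λ f → map (λ c → λ { Fin.zero → c ; (Fin.suc i) → f i }) (allFin k)) (allFuns n k)

perms : ∀ n → List (Fin n → Fin n)
perms n = filter (λ σ → all? (λ p → ¬? (σ (proj₁ p) Fin.≟ σ (proj₂ p))) (pairs n)) (allFuns n n)

inversions : ∀ {n} → (Fin n → Fin n) → ℕ
inversions {n} σ = length (filter (λ p → σ (proj₂ p) Fin.<? σ (proj₁ p)) (pairs n))

sign : ∀ {n} → (Fin n → Fin n) → ℤ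
sign σ = (- ℤ.1ℤ) ℤ.^ inversions σ

sumℤ : List ℤ → ℤ
sumℤ = foldr ℤ._+_ ℤ.0ℤ

prodℤ : List ℤ → ℤ
prodℤ = foldr ℤ._*_ ℤ.1ℤ

permArgs : ∀ {n} → ℕ → (Fin n → ℕ) → (Fin n → Fin n) → Fin n → ℕ
permArgs m a σ Fin.zero    = m ℕ.* a (σ Fin.zero)
permArgs m a σ (Fin.suc i) = a (σ (Fin.suc i))

𝓗 : ∀ {n} → ℕ → (Fin n → ℕ) → ℤ
𝓗 {n} m a = sumℤ (map (λ σ → sign σ ℤ.* + h (permArgs m a σ)) (perms n))

-- Weight every map σ : Fin n → Fin n by its signature (the sign of σ if σ is a bijection, 0 otherwise);
-- then 𝓗 m a = K_n(m; a), where K_n(y; b) = alternatingH n y b = Σ_σ signature σ · h(y b_σ(1), b_σ(2), …, b_σ(n)).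
-- Expanding along the first coordinate like a determinant gives
--   K_{n+1}(y; b) = Σ_c (-1)^c Σ_{z=1}^{b_c y} K_n(z; b without b_c),
-- and by induction n! K_n(y; b) = y^n ∏ b_i ∏_{i<j} (b_i - b_j).  In the inductive step the alternating
-- sum over c is a Laplace expansion of a Vandermonde determinant along its last column: it sends N^(k+1)
-- to 0 for k < n and N^(n+1) to y^(n+1) ∏ b_i ∏_{i<j} (b_i - b_j).  As (n+1) Σ_{z=1}^{N} z^n is N^(n+1)
-- plus lower powers with rational coefficients, the lower part is removed by induction on the degree,
-- through (k+1) p(z) = t (z^(k+1) - (z-1)^(k+1)) + r(z), where t is the top coefficient of p and deg r < k.

module Submission where

open import Defs
open import Data.Bool using (true; false; if_then_else_)
open import Data.Empty using (⊥-elim)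
open import Data.Fin as Fin using (Fin; zero; suc; punchIn; punchOut; toℕ)
import Data.Fin.Properties as Fin
open import Data.Integer as ℤ using (ℤ; +_; -_; _+_; _*_; _-_; 0ℤ; 1ℤ; _^_)
open import Data.Integer.Properties
open import Data.Integer.Tactic.RingSolver using (solve-∀)
open import Data.List as List using (List; _++_; map; concatMap; filter; allFin)
import Data.List.Properties as List
open import Data.List.Relation.Unary.All as All using (All; all?)
open import Data.Nat as ℕ using (ℕ; zero; suc; _!; _≤_; _<_; s≤s)
import Data.Nat.Properties as ℕ
open import Data.Product using (_×_; _,_; proj₁; proj₂; Σ; ∃)
open import Data.Sum using (inj₁; inj₂)
open import Data.Vec.Functional as Vector using (_∷_)
open import Function using (_∘_; id; mk⇔)
open import Function.Definitions using (Injective)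
open import Relation.Binary using (tri<; tri≈; tri>)
open import Relation.Binary.PropositionalEquality
open import Relation.Nullary using (Dec; yes; no; does; ¬_; ¬?)
open import Relation.Nullary.Decidable using (dec-true; dec-false; does-⇔)
open import Relation.Unary using (Decidable)
open import Algebra.Properties.Semiring.Sum +-*-semiring
  using (sum-remove; ∑-distrib-+; ∑-comm; *-distribˡ-sum)
  renaming (sum to ∑; sum-cong-≗ to ∑-cong; sum-replicate-zero to ∑-zero)
open import Algebra.Properties.CommutativeMonoid.Sum *-1-commutativeMonoid
  using ()
  renaming (sum to ∏; sum-remove to ∏-remove; ∑-distrib-+ to ∏-distrib-*;
            sum-cong-≗ to ∏-cong; sum-replicate-zero to ∏-one)
open ≡-Reasoning

foldr-tabulate : ∀ {A B : Set} (_⊕_ : A → B → B) e {n} (f : Fin n → A) →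
  List.foldr _⊕_ e (List.tabulate f) ≡ Vector.foldr _⊕_ e f
foldr-tabulate _⊕_ e {zero}  f = refl
foldr-tabulate _⊕_ e {suc n} f = cong (f zero ⊕_) (foldr-tabulate _⊕_ e (f ∘ suc))

sumℤ-allFin : ∀ {n} (f : Fin n → ℤ) → sumℤ (map f (allFin n)) ≡ ∑ f
sumℤ-allFin f = trans (cong sumℤ (List.map-tabulate id f)) (foldr-tabulate _+_ 0ℤ f)

prodℤ-allFin : ∀ {n} (f : Fin n → ℤ) → prodℤ (map f (allFin n)) ≡ ∏ f
prodℤ-allFin f = trans (cong prodℤ (List.map-tabulate id f)) (foldr-tabulate _*_ 1ℤ f)

module MonoidFold {A : Set} (_∙_ : A → A → A) (ε : A)
  (identityˡ : ∀ x → ε ∙ x ≡ x) (assoc : ∀ x y z → (x ∙ y) ∙ z ≡ x ∙ (y ∙ z)) where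

  fold : List A → A
  fold = List.foldr _∙_ ε

  fold-++ : ∀ xs ys → fold (xs ++ ys) ≡ fold xs ∙ fold ys
  fold-++ List.[]       ys = sym (identityˡ _)
  fold-++ (x List.∷ xs) ys = trans (cong (x ∙_) (fold-++ xs ys)) (sym (assoc x _ _))

  fold-concatMap : ∀ {B C : Set} (g : C → A) (F : B → List C) xs →
    fold (map g (concatMap F xs)) ≡ fold (map (λ x → fold (map g (F x))) xs)
  fold-concatMap g F List.[]       = refl
  fold-concatMap g F (x List.∷ xs) = begin
    fold (map g (F x ++ concatMap F xs))                ≡⟨ cong fold (List.map-++ g (F x) _) ⟩
    fold (map g (F x) ++ map g (concatMap F xs))        ≡⟨ fold-++ (map g (F x)) _ ⟩
    fold (map g (F x)) ∙ fold (map g (concatMap F xs))  ≡⟨ cong (_ ∙_) (fold-concatMap g F xs) ⟩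
    fold (map g (F x)) ∙ fold (map (λ x → fold (map g (F x))) xs) ∎

  fold-filter : ∀ {B : Set} {P : B → Set} (P? : Decidable P) (g : B → A) xs →
    fold (map g (filter P? xs)) ≡ fold (map (λ x → if does (P? x) then g x else ε) xs)
  fold-filter P? g List.[] = refl
  fold-filter P? g (x List.∷ xs) with does (P? x)
  ... | true  = cong (g x ∙_) (fold-filter P? g xs)
  ... | false = trans (fold-filter P? g xs) (sym (identityˡ _))

open MonoidFold _+_ 0ℤ +-identityˡ +-assoc using ()
  renaming (fold-concatMap to sumℤ-concatMap)
open MonoidFold _*_ 1ℤ *-identityˡ *-assoc using ()
  renaming (fold-concatMap to prodℤ-concatMap; fold-filter to prodℤ-filter)

∏-zero : ∀ {n} (f : Fin n → ℤ) j → f j ≡ 0ℤ → ∏ f ≡ 0ℤ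
∏-zero {suc n} f j fj≡0 = begin
  ∏ f                           ≡⟨ ∏-remove {n} {j} f ⟩
  f j * ∏ (f ∘ punchIn j)       ≡⟨ cong (_* ∏ (f ∘ punchIn j)) fj≡0 ⟩
  0ℤ * ∏ (f ∘ punchIn j)        ≡⟨ *-zeroˡ (∏ (f ∘ punchIn j)) ⟩
  0ℤ                            ∎

∏< : ∀ {n} → (Fin n → Fin n → ℤ) → ℤ
∏< {zero}  φ = 1ℤ
∏< {suc n} φ = ∏ (λ j → φ zero (suc j)) * ∏< (λ i j → φ (suc i) (suc j))

∏<-cong : ∀ {n} {φ ψ : Fin n → Fin n → ℤ} → (∀ i j → φ i j ≡ ψ i j) → ∏< φ ≡ ∏< ψ
∏<-cong {zero}  eq = refl
∏<-cong {suc n} eq =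
  cong₂ _*_ (∏-cong (λ j → eq zero (suc j))) (∏<-cong (λ i j → eq (suc i) (suc j)))

∏<-zero : ∀ {n} (φ : Fin n → Fin n → ℤ) i j → i Fin.< j → φ i j ≡ 0ℤ → ∏< φ ≡ 0ℤ
∏<-zero φ zero (suc j) _ φij≡0 = begin
  ∏ (λ j → φ zero (suc j)) * ∏< φ′  ≡⟨ cong (_* ∏< φ′) (∏-zero (λ j → φ zero (suc j)) j φij≡0) ⟩
  0ℤ * ∏< φ′                        ≡⟨ *-zeroˡ (∏< φ′) ⟩
  0ℤ                                ∎
  where φ′ = λ i j → φ (suc i) (suc j)
∏<-zero φ (suc i) (suc j) (s≤s i<j) φij≡0 = begin
  ∏ (λ j → φ zero (suc j)) * ∏< φ′  ≡⟨ cong (∏ (λ j → φ zero (suc j)) *_) (∏<-zero φ′ i j i<j φij≡0) ⟩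
  ∏ (λ j → φ zero (suc j)) * 0ℤ     ≡⟨ *-zeroʳ (∏ (λ j → φ zero (suc j))) ⟩
  0ℤ                                ∎
  where φ′ = λ i j → φ (suc i) (suc j)

∏-columns : ∀ {n} (φ : Fin n → Fin n → ℤ) →
  ∏ (λ j → ∏ (λ i → if does (i Fin.<? j) then φ i j else 1ℤ)) ≡ ∏< φ
∏-columns {zero}  φ = refl
-- Column 0 is empty, and column (suc j) starts with φ zero (suc j).
∏-columns {suc n} φ = begin
  ∏ {suc n} (λ _ → 1ℤ) * ∏ (λ j → φ zero (suc j) * column j)
    ≡⟨ cong₂ _*_ (∏-one (suc n)) (∏-distrib-* (λ j → φ zero (suc j)) column) ⟩
  1ℤ * (∏ (λ j → φ zero (suc j)) * ∏ column)
    ≡⟨ *-identityˡ (∏ (λ j → φ zero (suc j)) * ∏ column) ⟩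
  ∏ (λ j → φ zero (suc j)) * ∏ column
    ≡⟨ cong (∏ (λ j → φ zero (suc j)) *_) (∏-columns (λ i j → φ (suc i) (suc j))) ⟩
  ∏< φ ∎
  where
  column : Fin n → ℤ
  column j = ∏ (λ i → if does (i Fin.<? j) then φ (suc i) (suc j) else 1ℤ)

prodℤ-pairs : ∀ n (φ : Fin n → Fin n → ℤ) →
  prodℤ (map (λ p → φ (proj₁ p) (proj₂ p)) (pairs n)) ≡ ∏< φ
prodℤ-pairs n φ = begin
  prodℤ (map (λ p → φ (proj₁ p) (proj₂ p)) (pairs n))
    ≡⟨ prodℤ-concatMap _ _ (allFin n) ⟩
  prodℤ (map (λ j → prodℤ (map (λ p → φ (proj₁ p) (proj₂ p)) (map (λ i → (i , j)) (below j)))) (allFin n))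
    ≡⟨ cong prodℤ (List.map-cong column (allFin n)) ⟩
  prodℤ (map (λ j → ∏ (λ i → if does (i Fin.<? j) then φ i j else 1ℤ)) (allFin n))
    ≡⟨ prodℤ-allFin (λ j → ∏ (λ i → if does (i Fin.<? j) then φ i j else 1ℤ)) ⟩
  ∏ (λ j → ∏ (λ i → if does (i Fin.<? j) then φ i j else 1ℤ))
    ≡⟨ ∏-columns φ ⟩
  ∏< φ ∎
  where
  below : Fin n → List (Fin n)
  below j = filter (Fin._<? j) (allFin n)
  column : ∀ j → prodℤ (map (λ p → φ (proj₁ p) (proj₂ p)) (map (λ i → (i , j)) (below j)))
               ≡ ∏ (λ i → if does (i Fin.<? j) then φ i j else 1ℤ)
  column j = begin
    prodℤ (map (λ p → φ (proj₁ p) (proj₂ p)) (map (λ i → (i , j)) (below j)))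
      ≡⟨ cong prodℤ (sym (List.map-∘ (below j))) ⟩
    prodℤ (map (λ i → φ i j) (below j))
      ≡⟨ prodℤ-filter (Fin._<? j) (λ i → φ i j) (allFin n) ⟩
    prodℤ (map (λ i → if does (i Fin.<? j) then φ i j else 1ℤ) (allFin n))
      ≡⟨ prodℤ-allFin (λ i → if does (i Fin.<? j) then φ i j else 1ℤ) ⟩
    ∏ (λ i → if does (i Fin.<? j) then φ i j else 1ℤ) ∎

Extensional : ∀ {n k} → ((Fin n → Fin k) → ℤ) → Set
Extensional G = ∀ {f g} → (∀ i → f i ≡ g i) → G f ≡ G g

∷-congʳ : ∀ {n k} (c : Fin k) {f g : Fin n → Fin k} → (∀ i → f i ≡ g i) → ∀ i → (c ∷ f) i ≡ (c ∷ g) i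
∷-congʳ c f≗g zero    = refl
∷-congʳ c f≗g (suc i) = f≗g i

∑fun : ∀ n k → ((Fin n → Fin k) → ℤ) → ℤ
∑fun zero    k G = G (λ ())
∑fun (suc n) k G = ∑fun n k (λ f → ∑ (λ c → G (c ∷ f)))

∑fun-cong : ∀ n k {G H : (Fin n → Fin k) → ℤ} → (∀ f → G f ≡ H f) → ∑fun n k G ≡ ∑fun n k H
∑fun-cong zero    k G≗H = G≗H (λ ())
∑fun-cong (suc n) k G≗H = ∑fun-cong n k (λ f → ∑-cong (λ c → G≗H (c ∷ f)))

∑fun-distrib-+ : ∀ n k (G H : (Fin n → Fin k) → ℤ) →
  ∑fun n k (λ f → G f + H f) ≡ ∑fun n k G + ∑fun n k H
∑fun-distrib-+ zero    k G H = refl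
∑fun-distrib-+ (suc n) k G H = begin
  ∑fun n k (λ f → ∑ (λ c → G (c ∷ f) + H (c ∷ f)))
    ≡⟨ ∑fun-cong n k (λ f → ∑-distrib-+ (λ c → G (c ∷ f)) (λ c → H (c ∷ f))) ⟩
  ∑fun n k (λ f → ∑ (λ c → G (c ∷ f)) + ∑ (λ c → H (c ∷ f)))
    ≡⟨ ∑fun-distrib-+ n k _ _ ⟩
  ∑fun (suc n) k G + ∑fun (suc n) k H ∎

∑fun-zero : ∀ n k → ∑fun n k (λ _ → 0ℤ) ≡ 0ℤ
∑fun-zero zero    k = refl
∑fun-zero (suc n) k = trans (∑fun-cong n k (λ _ → ∑-zero k)) (∑fun-zero n k)

*-distribˡ-∑fun : ∀ n k a (G : (Fin n → Fin k) → ℤ) → a * ∑fun n k G ≡ ∑fun n k (λ f → a * G f)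
*-distribˡ-∑fun zero    k a G = refl
*-distribˡ-∑fun (suc n) k a G =
  trans (*-distribˡ-∑fun n k a _) (∑fun-cong n k (λ f → *-distribˡ-sum a (λ c → G (c ∷ f))))

∑fun-comm : ∀ n k {m} (F : (Fin n → Fin k) → Fin m → ℤ) →
  ∑fun n k (λ f → ∑ (F f)) ≡ ∑ (λ c → ∑fun n k (λ f → F f c))
∑fun-comm zero    k F = refl
∑fun-comm (suc n) k F = begin
  ∑fun n k (λ f → ∑ (λ d → ∑ (F (d ∷ f))))
    ≡⟨ ∑fun-cong n k (λ f → ∑-comm (λ d → F (d ∷ f))) ⟩
  ∑fun n k (λ f → ∑ (λ c → ∑ (λ d → F (d ∷ f) c)))
    ≡⟨ ∑fun-comm n k (λ f c → ∑ (λ d → F (d ∷ f) c)) ⟩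
  ∑ (λ c → ∑fun (suc n) k (λ f → F f c)) ∎

sumℤ-allFuns : ∀ n k (G : (Fin n → Fin k) → ℤ) → Extensional G →
  sumℤ (map G (allFuns n k)) ≡ ∑fun n k G
sumℤ-allFuns zero    k G ext = trans (+-identityʳ (G (λ ()))) (ext (λ ()))
sumℤ-allFuns (suc n) k G ext = begin
  sumℤ (map G (allFuns (suc n) k))
    ≡⟨ sumℤ-concatMap G _ (allFuns n k) ⟩
  sumℤ (map (λ f → sumℤ (map G (map (λ c → _) (allFin k)))) (allFuns n k))
    ≡⟨ cong sumℤ (List.map-cong (λ f → row f _ (λ { c zero → refl ; c (suc i) → refl })) (allFuns n k)) ⟩
  sumℤ (map (λ f → ∑ (λ c → G (c ∷ f))) (allFuns n k))
    ≡⟨ sumℤ-allFuns n k _ (λ f≗g → ∑-cong (λ c → ext (∷-congʳ c f≗g))) ⟩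
  ∑fun (suc n) k G ∎
  where
  row : ∀ f (H : Fin k → Fin (suc n) → Fin k) → (∀ c i → H c i ≡ (c ∷ f) i) →
        sumℤ (map G (map H (allFin k))) ≡ ∑ (λ c → G (c ∷ f))
  row f H H≗∷ = begin
    sumℤ (map G (map H (allFin k)))  ≡⟨ cong sumℤ (sym (List.map-∘ (allFin k))) ⟩
    sumℤ (map (G ∘ H) (allFin k))    ≡⟨ sumℤ-allFin (G ∘ H) ⟩
    ∑ (G ∘ H)                        ≡⟨ ∑-cong (λ c → ext (H≗∷ c)) ⟩
    ∑ (λ c → G (c ∷ f))              ∎

∑fun-punchIn : ∀ n {k} (c : Fin (suc k)) (G : (Fin n → Fin (suc k)) → ℤ) → Extensional G →
  (∀ f j → f j ≡ c → G f ≡ 0ℤ) → ∑fun n (suc k) G ≡ ∑fun n k (λ τ → G (punchIn c ∘ τ))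
∑fun-punchIn zero    c G ext G-hit = ext (λ ())
∑fun-punchIn (suc n) {k} c G ext G-hit = begin
  ∑fun n (suc k) (λ f → ∑ (λ d → G (d ∷ f)))
    ≡⟨ ∑fun-cong n (suc k) drop-c ⟩
  ∑fun n (suc k) (λ f → ∑ (λ e → G (punchIn c e ∷ f)))
    ≡⟨ ∑fun-comm n (suc k) (λ f e → G (punchIn c e ∷ f)) ⟩
  ∑ (λ e → ∑fun n (suc k) (λ f → G (punchIn c e ∷ f)))
    ≡⟨ ∑-cong (λ e → ∑fun-punchIn n c (λ f → G (punchIn c e ∷ f))
                     (λ f≗g → ext (∷-congʳ (punchIn c e) f≗g)) (λ f j → G-hit (punchIn c e ∷ f) (suc j))) ⟩
  ∑ (λ e → ∑fun n k (λ τ → G (punchIn c e ∷ (punchIn c ∘ τ))))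
    ≡⟨ sym (∑fun-comm n k (λ τ e → G (punchIn c e ∷ (punchIn c ∘ τ)))) ⟩
  ∑fun n k (λ τ → ∑ (λ e → G (punchIn c e ∷ (punchIn c ∘ τ))))
    ≡⟨ ∑fun-cong n k (λ τ → ∑-cong (λ e → ext {punchIn c e ∷ (punchIn c ∘ τ)} {punchIn c ∘ (e ∷ τ)}
                                                 (λ { zero → refl ; (suc i) → refl }))) ⟩
  ∑fun (suc n) k (λ τ → G (punchIn c ∘ τ)) ∎
  where
  drop-c : ∀ f → ∑ (λ d → G (d ∷ f)) ≡ ∑ (λ e → G (punchIn c e ∷ f))
  drop-c f = begin
    ∑ (λ d → G (d ∷ f))                              ≡⟨ sum-remove {i = c} (λ d → G (d ∷ f)) ⟩
    G (c ∷ f) + ∑ (λ e → G (punchIn c e ∷ f))        ≡⟨ cong (_+ ∑ (λ e → G (punchIn c e ∷ f))) (G-hit (c ∷ f) zero refl) ⟩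
    0ℤ + ∑ (λ e → G (punchIn c e ∷ f))               ≡⟨ +-identityˡ (∑ (λ e → G (punchIn c e ∷ f))) ⟩
    ∑ (λ e → G (punchIn c e ∷ f))                    ∎

altSign : ∀ {n} → Fin n → ℤ
altSign c = (- 1ℤ) ^ toℕ c

pairSign : ∀ {k} → Fin k → Fin k → ℤ
pairSign x y = if does (y Fin.<? x) then - 1ℤ else (if does (x Fin.≟ y) then 0ℤ else 1ℤ)

pairSign-refl : ∀ {k} (x : Fin k) → pairSign x x ≡ 0ℤ
pairSign-refl x rewrite dec-false (x Fin.<? x) (Fin.<-irrefl refl) | dec-true (x Fin.≟ x) refl = refl

does-punchIn-< : ∀ {n} (c : Fin (suc n)) (x y : Fin n) →
  does (punchIn c x Fin.<? punchIn c y) ≡ does (x Fin.<? y)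
does-punchIn-< zero    x       y       = refl
does-punchIn-< (suc c) zero    zero    = refl
does-punchIn-< (suc c) zero    (suc y) = refl
does-punchIn-< (suc c) (suc x) zero    = refl
does-punchIn-< (suc c) (suc x) (suc y) = does-punchIn-< c x y

pairSign-punchIn : ∀ {n} (c : Fin (suc n)) (x y : Fin n) → pairSign (punchIn c x) (punchIn c y) ≡ pairSign x y
pairSign-punchIn c x y =
  cong₂ (λ y<x x≡y → if y<x then - 1ℤ else (if x≡y then 0ℤ else 1ℤ))
    (does-punchIn-< c y x)
    (does-⇔ (mk⇔ (Fin.punchIn-injective c x y) (cong (punchIn c))) (punchIn c x Fin.≟ punchIn c y) (x Fin.≟ y))

∏-pairSign-punchIn : ∀ {n} (c : Fin (suc n)) → ∏ (λ e → pairSign c (punchIn c e)) ≡ altSign c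
∏-pairSign-punchIn {n}     zero    = ∏-one n
∏-pairSign-punchIn {suc n} (suc c) = cong (- 1ℤ *_) (∏-pairSign-punchIn c)

∏-injective : ∀ {n} (τ : Fin n → Fin n) → Injective _≡_ _≡_ τ → (u : Fin n → ℤ) → ∏ (u ∘ τ) ≡ ∏ u
∏-injective {zero}  τ inj u = refl
∏-injective {suc n} τ inj u = begin
  u (τ zero) * ∏ (u ∘ τ ∘ suc)                  ≡⟨ cong (u (τ zero) *_) (∏-cong (λ j → cong u (sym (Fin.punchIn-punchOut (τ₀≢ j))))) ⟩
  u (τ zero) * ∏ (u ∘ punchIn (τ zero) ∘ τ′)    ≡⟨ cong (u (τ zero) *_) (∏-injective τ′ τ′-injective (u ∘ punchIn (τ zero))) ⟩
  u (τ zero) * ∏ (u ∘ punchIn (τ zero))         ≡⟨ sym (∏-remove {n} {τ zero} u) ⟩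
  ∏ u                                           ∎
  where
  τ₀≢ : ∀ j → τ zero ≢ τ (suc j)
  τ₀≢ j eq with inj eq
  ... | ()
  τ′ : Fin n → Fin n
  τ′ j = punchOut (τ₀≢ j)
  τ′-injective : Injective _≡_ _≡_ τ′
  τ′-injective eq = Fin.suc-injective (inj (Fin.punchOut-injective (τ₀≢ _) (τ₀≢ _) eq))

-- For injective σ this is sign σ; otherwise it vanishes.
signature : ∀ {n k} → (Fin n → Fin k) → ℤ
signature σ = ∏< (λ i j → pairSign (σ i) (σ j))

signature-cong : ∀ {n k} → Extensional (signature {n} {k})
signature-cong f≗g = ∏<-cong (λ i j → cong₂ pairSign (f≗g i) (f≗g j))

signature-punchIn : ∀ {n k} (c : Fin (suc k)) (τ : Fin n → Fin k) → signature (punchIn c ∘ τ) ≡ signature τ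
signature-punchIn c τ = ∏<-cong (λ i j → pairSign-punchIn c (τ i) (τ j))

signature-collision : ∀ {n k} (τ : Fin n → Fin k) {i j} → i ≢ j → τ i ≡ τ j → signature τ ≡ 0ℤ
signature-collision τ {i} {j} i≢j τi≡τj with Fin.<-cmp i j
... | tri< i<j _ _ = ∏<-zero _ i j i<j (trans (cong (λ x → pairSign x (τ j)) τi≡τj) (pairSign-refl (τ j)))
... | tri≈ _ i≡j _ = ⊥-elim (i≢j i≡j)
... | tri> _ _ j<i = ∏<-zero _ j i j<i (trans (cong (λ x → pairSign x (τ i)) (sym τi≡τj)) (pairSign-refl (τ i)))

signature≢0⇒injective : ∀ {n k} (τ : Fin n → Fin k) → signature τ ≢ 0ℤ → Injective _≡_ _≡_ τ
signature≢0⇒injective τ sig≢0 {i} {j} τi≡τj with i Fin.≟ j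
... | yes i≡j = i≡j
... | no  i≢j = ⊥-elim (sig≢0 (signature-collision τ i≢j τi≡τj))

signature-insert : ∀ {n} (c : Fin (suc n)) (τ : Fin n → Fin n) →
  ∏ (λ j → pairSign c (punchIn c (τ j))) * signature τ ≡ altSign c * signature τ
signature-insert c τ with signature τ ℤ.≟ 0ℤ
... | yes sig≡0 rewrite sig≡0 =
  trans (*-zeroʳ (∏ (λ j → pairSign c (punchIn c (τ j))))) (sym (*-zeroʳ (altSign c)))
... | no  sig≢0 = cong (_* signature τ) (begin
  ∏ (λ j → pairSign c (punchIn c (τ j)))  ≡⟨ ∏-injective τ (signature≢0⇒injective τ sig≢0) (λ e → pairSign c (punchIn c e)) ⟩
  ∏ (λ e → pairSign c (punchIn c e))      ≡⟨ ∏-pairSign-punchIn c ⟩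
  altSign c                               ∎)

-- signature (c ∷ f) is definitionally ∏ (pairSign c ∘ f) * signature f; the maps f that hit c vanish,
-- and the others are punchIn c ∘ τ.
laplace : ∀ n (G : (Fin (suc n) → Fin (suc n)) → ℤ) → Extensional G →
  ∑fun (suc n) (suc n) (λ σ → signature σ * G σ) ≡
  ∑ (λ c → altSign c * ∑fun n n (λ τ → signature τ * G (c ∷ (punchIn c ∘ τ))))
laplace n G ext = begin
  ∑fun n (suc n) (λ f → ∑ (λ c → H c f))
    ≡⟨ ∑fun-comm n (suc n) (λ f c → H c f) ⟩
  ∑ (λ c → ∑fun n (suc n) (H c))
    ≡⟨ ∑-cong (λ c → ∑fun-punchIn n c (H c) (H-ext c) (H-hit c)) ⟩
  ∑ (λ c → ∑fun n n (λ τ → H c (punchIn c ∘ τ)))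
    ≡⟨ ∑-cong (λ c → trans (∑fun-cong n n (H-punchIn c))
                           (sym (*-distribˡ-∑fun n n (altSign c) (λ τ → signature τ * G (c ∷ (punchIn c ∘ τ)))))) ⟩
  ∑ (λ c → altSign c * ∑fun n n (λ τ → signature τ * G (c ∷ (punchIn c ∘ τ)))) ∎
  where
  H : Fin (suc n) → (Fin n → Fin (suc n)) → ℤ
  H c f = ∏ (λ j → pairSign c (f j)) * signature f * G (c ∷ f)

  H-ext : ∀ c → Extensional (H c)
  H-ext c f≗g = cong₂ _*_ (cong₂ _*_ (∏-cong (λ j → cong (pairSign c) (f≗g j))) (signature-cong f≗g))
                          (ext (∷-congʳ c f≗g))

  H-hit : ∀ c f j → f j ≡ c → H c f ≡ 0ℤ
  H-hit c f j fj≡c = begin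
    ∏ (λ j → pairSign c (f j)) * signature f * G (c ∷ f)  ≡⟨ cong (λ x → x * signature f * G (c ∷ f)) ∏≡0 ⟩
    0ℤ * signature f * G (c ∷ f)                          ≡⟨ cong (_* G (c ∷ f)) (*-zeroˡ (signature f)) ⟩
    0ℤ * G (c ∷ f)                                        ≡⟨ *-zeroˡ (G (c ∷ f)) ⟩
    0ℤ                                                    ∎
    where ∏≡0 = ∏-zero (λ j → pairSign c (f j)) j (trans (cong (pairSign c) fj≡c) (pairSign-refl c))

  H-punchIn : ∀ c τ → H c (punchIn c ∘ τ) ≡ altSign c * (signature τ * G (c ∷ (punchIn c ∘ τ)))
  H-punchIn c τ = begin
    ∏ (λ j → pairSign c (punchIn c (τ j))) * signature (punchIn c ∘ τ) * G′
      ≡⟨ cong (λ x → ∏ (λ j → pairSign c (punchIn c (τ j))) * x * G′) (signature-punchIn c τ) ⟩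
    ∏ (λ j → pairSign c (punchIn c (τ j))) * signature τ * G′
      ≡⟨ cong (_* G′) (signature-insert c τ) ⟩
    altSign c * signature τ * G′
      ≡⟨ *-assoc (altSign c) (signature τ) G′ ⟩
    altSign c * (signature τ * G′) ∎
    where G′ = G (c ∷ (punchIn c ∘ τ))

-- f is a polynomial function of degree ≤ k, in Horner form, whose coefficient of x ^ k is t.
data Poly : ℕ → ℤ → (ℤ → ℤ) → Set where
  const  : ∀ {t f} → (∀ x → f x ≡ t) → Poly 0 t f
  horner : ∀ {k t f} (g : ℤ → ℤ) d → Poly k t g → (∀ x → f x ≡ x * g x + d) → Poly (suc k) t f

poly-resp : ∀ {k t f f′} → Poly k t f → (∀ x → f x ≡ f′ x) → Poly k t f′
poly-resp (const f≡t)        f≗f′ = const (λ x → trans (sym (f≗f′ x)) (f≡t x))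
poly-resp (horner g d P f≡) f≗f′ = horner g d P (λ x → trans (sym (f≗f′ x)) (f≡ x))

poly-+const : ∀ {k t f} → Poly (suc k) t f → ∀ e → Poly (suc k) t (λ x → f x + e)
poly-+const (horner g d P f≡) e = horner g (d + e) P (λ x → trans (cong (_+ e) (f≡ x)) (+-assoc (x * g x) d e))

poly-+ : ∀ {k t u f g} → Poly k t f → Poly k u g → Poly k (t + u) (λ x → f x + g x)
poly-+ (const f≡t) (const g≡u) = const (λ x → cong₂ _+_ (f≡t x) (g≡u x))
poly-+ (horner f′ d P f≡) (horner g′ e Q g≡) =
  horner (λ x → f′ x + g′ x) (d + e) (poly-+ P Q) (λ x → trans (cong₂ _+_ (f≡ x) (g≡ x)) (regroup x (f′ x) (g′ x) d e))
  where regroup : ∀ x a b c d → (x * a + c) + (x * b + d) ≡ x * (a + b) + (c + d)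
        regroup = solve-∀

poly-scale : ∀ {k t f} a → Poly k t f → Poly k (a * t) (λ x → a * f x)
poly-scale a (const f≡t)       = const (λ x → cong (a *_) (f≡t x))
poly-scale a (horner g d P f≡) =
  horner (λ x → a * g x) (a * d) (poly-scale a P) (λ x → trans (cong (a *_) (f≡ x)) (distrib a x (g x) d))
  where distrib : ∀ a x b d → a * (x * b + d) ≡ x * (a * b) + a * d
        distrib = solve-∀

poly-weaken : ∀ {k t f} → Poly k t f → Poly (suc k) 0ℤ f
poly-weaken {t = t} (const f≡t) =
  horner (λ _ → 0ℤ) t (const (λ _ → refl)) (λ x → trans (f≡t x) (sym (trans (cong (_+ t) (*-zeroʳ x)) (+-identityˡ t))))
poly-weaken (horner g d P f≡) = horner g d (poly-weaken P) f≡

poly-raise : ∀ {k n t f} → k < n → Poly k t f → Poly n 0ℤ f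
poly-raise {k} (s≤s k≤n) P with ℕ.m≤n⇒m<n∨m≡n k≤n
... | inj₁ k<n  = poly-weaken (poly-raise k<n P)
... | inj₂ refl = poly-weaken P

poly-mulLinear : ∀ {k t f} β → Poly k t f → Poly (suc k) t (λ x → (x - β) * f x)
poly-mulLinear {t = t} β (const f≡t) =
  horner (λ _ → t) (- (β * t)) (const (λ _ → refl)) (λ x → trans (cong ((x - β) *_) (f≡t x)) (expand x β t))
  where expand : ∀ x β t → (x - β) * t ≡ x * t + - (β * t)
        expand = solve-∀
poly-mulLinear β (horner g d P f≡) =
  horner _ (- (β * d)) (poly-+const (poly-mulLinear β P) d) (λ x → trans (cong ((x - β) *_) (f≡ x)) (expand x β (g x) d))
  where expand : ∀ x β g d → (x - β) * (x * g + d) ≡ x * ((x - β) * g + d) + - (β * d)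
        expand = solve-∀

poly-factor : ∀ {k t f} → Poly (suc k) t f → ∀ β →
  Σ (ℤ → ℤ) λ q → Poly k t q × (∀ x → f x ≡ f β + (x - β) * q x)
poly-factor {t = t} {f} (horner g d (const g≡t) f≡) β = (λ _ → t) , const (λ _ → refl) , f-factor
  where
  f-factor : ∀ x → f x ≡ f β + (x - β) * t
  f-factor x = begin
    f x                       ≡⟨ f≡ x ⟩
    x * g x + d               ≡⟨ cong (λ y → x * y + d) (g≡t x) ⟩
    x * t + d                 ≡⟨ shift x β t d ⟩
    (β * t + d) + (x - β) * t ≡⟨ cong (_+ (x - β) * t) (sym (trans (f≡ β) (cong (λ y → β * y + d) (g≡t β)))) ⟩
    f β + (x - β) * t         ∎
    where shift : ∀ x β t d → x * t + d ≡ (β * t + d) + (x - β) * t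
          shift = solve-∀
poly-factor {f = f} (horner g d P@(horner _ _ _ _) f≡) β with poly-factor P β
... | q , Q , g-factor = (λ x → x * q x + g β) , poly-+const (horner q 0ℤ Q (λ x → sym (+-identityʳ (x * q x)))) (g β) , f-factor
  where
  f-factor : ∀ x → f x ≡ f β + (x - β) * (x * q x + g β)
  f-factor x = begin
    f x                                     ≡⟨ f≡ x ⟩
    x * g x + d                             ≡⟨ cong (λ y → x * y + d) (g-factor x) ⟩
    x * (g β + (x - β) * q x) + d           ≡⟨ shift x β (g β) (q x) d ⟩
    (β * g β + d) + (x - β) * (x * q x + g β) ≡⟨ cong (_+ (x - β) * (x * q x + g β)) (sym (f≡ β)) ⟩
    f β + (x - β) * (x * q x + g β)         ∎
    where shift : ∀ x β gβ qx d → x * (gβ + (x - β) * qx) + d ≡ (β * gβ + d) + (x - β) * (x * qx + gβ)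
          shift = solve-∀

poly-lower : ∀ {k f} → Poly (suc k) 0ℤ f → ∃ λ u → Poly k u f
poly-lower {zero} {f} (horner g d (const g≡0) f≡) = d , const f≡d
  where f≡d : ∀ x → f x ≡ d
        f≡d x = trans (f≡ x) (trans (cong (λ y → x * y + d) (g≡0 x)) (trans (cong (_+ d) (*-zeroʳ x)) (+-identityˡ d)))
poly-lower {suc k} (horner g d P f≡) with poly-lower P
... | u , Q = u , horner g d Q f≡

poly-pow : ∀ k → Poly k 1ℤ (_^ k)
poly-pow zero    = const (λ _ → refl)
poly-pow (suc k) = horner (_^ k) 0ℤ (poly-pow k) (λ x → sym (+-identityʳ (x ^ suc k)))

poly-dilate : ∀ {k t f} → Poly k t f → ∀ y → Poly k (t * y ^ k) (λ x → f (x * y))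
poly-dilate {t = t} (const f≡t) y = const (λ x → trans (f≡t (x * y)) (sym (*-identityʳ t)))
poly-dilate {suc k} {t} (horner g d P f≡) y =
  subst (λ u → Poly (suc k) u _) (swap y t (y ^ k))
    (horner _ d (poly-scale y (poly-dilate P y)) (λ x → trans (f≡ (x * y)) (cong (_+ d) (*-assoc x y _))))
  where swap : ∀ y t yᵏ → y * (t * yᵏ) ≡ t * (y * yᵏ)
        swap = solve-∀

rootProduct : ∀ {m} → (Fin m → ℤ) → ℤ → ℤ
rootProduct b x = ∏ (λ j → x - b j)

rootProduct-root : ∀ {m} (b : Fin m → ℤ) c → rootProduct b (b c) ≡ 0ℤ
rootProduct-root b c = ∏-zero (λ j → b c - b j) c (+-inverseʳ (b c))

poly-rootProduct : ∀ {m} (b : Fin m → ℤ) → Poly m 1ℤ (rootProduct b)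
poly-rootProduct {zero}  b = const (λ _ → refl)
poly-rootProduct {suc m} b = poly-mulLinear (b zero) (poly-rootProduct (b ∘ suc))

-- The difference quotient (rootProduct b β - rootProduct b x) / (β - x), as a polynomial in x.
rootQuotient : ∀ {m} → (Fin m → ℤ) → ℤ → ℤ → ℤ
rootQuotient {zero}  b β x = 0ℤ
rootQuotient {suc m} b β x = (β - b zero) * rootQuotient (b ∘ suc) β x + rootProduct (b ∘ suc) x

rootQuotient-spec : ∀ {m} (b : Fin m → ℤ) β x →
  (β - x) * rootQuotient b β x ≡ rootProduct b β - rootProduct b x
rootQuotient-spec {zero}  b β x = *-zeroʳ (β - x)
rootQuotient-spec {suc m} b β x = begin
  (β - x) * ((β - b₀) * q + P x)             ≡⟨ distrib β x b₀ q (P x) ⟩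
  (β - b₀) * ((β - x) * q) + (β - x) * P x   ≡⟨ cong (λ y → (β - b₀) * y + (β - x) * P x) (rootQuotient-spec (b ∘ suc) β x) ⟩
  (β - b₀) * (P β - P x) + (β - x) * P x      ≡⟨ regroup β x b₀ (P β) (P x) ⟩
  (β - b₀) * P β - (x - b₀) * P x             ∎
  where
  b₀ = b zero
  q  = rootQuotient (b ∘ suc) β x
  P  = rootProduct (b ∘ suc)
  distrib : ∀ β x b₀ q p → (β - x) * ((β - b₀) * q + p) ≡ (β - b₀) * ((β - x) * q) + (β - x) * p
  distrib = solve-∀
  regroup : ∀ β x b₀ p₁ p₂ → (β - b₀) * (p₁ - p₂) + (β - x) * p₂ ≡ (β - b₀) * p₁ - (x - b₀) * p₂
  regroup = solve-∀

rootQuotient-root : ∀ {m} (b : Fin (suc m) → ℤ) β c → rootQuotient b β (b c) ≡ ∏ (λ j → β - b (punchIn c j))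
rootQuotient-root b β zero = begin
  (β - b₀) * rootQuotient (b ∘ suc) β b₀ + P b₀  ≡⟨ cong (_+ P b₀) (rootQuotient-spec (b ∘ suc) β b₀) ⟩
  (P β - P b₀) + P b₀                            ≡⟨ cancel (P β) (P b₀) ⟩
  P β                                            ∎
  where
  b₀ = b zero
  P  = rootProduct (b ∘ suc)
  cancel : ∀ a c → (a - c) + c ≡ a
  cancel = solve-∀
rootQuotient-root {suc m} b β (suc c) = begin
  (β - b zero) * rootQuotient (b ∘ suc) β (b (suc c)) + rootProduct (b ∘ suc) (b (suc c))
    ≡⟨ cong₂ (λ u v → (β - b zero) * u + v) (rootQuotient-root (b ∘ suc) β c) (rootProduct-root (b ∘ suc) c) ⟩
  (β - b zero) * ∏ (λ j → β - b (suc (punchIn c j))) + 0ℤ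
    ≡⟨ +-identityʳ ((β - b zero) * ∏ (λ j → β - b (suc (punchIn c j)))) ⟩
  (β - b zero) * ∏ (λ j → β - b (suc (punchIn c j))) ∎

poly-rootQuotient : ∀ {m} (b : Fin (suc m) → ℤ) β → Poly m 1ℤ (rootQuotient b β)
poly-rootQuotient {zero}  b β = const (λ x → cong (_+ 1ℤ) (*-zeroʳ (β - b zero)))
poly-rootQuotient {suc m} b β =
  subst (λ u → Poly (suc m) u (rootQuotient b β)) (cong (_+ 1ℤ) (*-zeroʳ (β - b zero)))
    (poly-+ (poly-scale (β - b zero) (poly-weaken (poly-rootQuotient (b ∘ suc) β))) (poly-rootProduct (b ∘ suc)))

vandermonde : ∀ {n} → (Fin n → ℤ) → ℤ
vandermonde b = ∏< (λ i j → b i - b j)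

-- Laplace expansion, along the last column w, of the determinant with rows (1, b c, …, (b c) ^ (n - 1), w c).
cofactorSum : ∀ {n} → (Fin (suc n) → ℤ) → (Fin (suc n) → ℤ) → ℤ
cofactorSum b w = ∑ (λ c → altSign c * (vandermonde (b ∘ punchIn c) * w c))

cofactorSum-cong : ∀ {n} (b : Fin (suc n) → ℤ) {w w′} → (∀ c → w c ≡ w′ c) → cofactorSum b w ≡ cofactorSum b w′
cofactorSum-cong b w≗w′ = ∑-cong (λ c → cong (λ x → altSign c * (vandermonde (b ∘ punchIn c) * x)) (w≗w′ c))

cofactorSum-linear : ∀ {n} (b : Fin (suc n) → ℤ) a w w′ →
  cofactorSum b (λ c → a * w c + w′ c) ≡ a * cofactorSum b w + cofactorSum b w′
cofactorSum-linear b a w w′ = begin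
  ∑ (λ c → s c * (V c * (a * w c + w′ c)))
    ≡⟨ ∑-cong (λ c → distrib (s c) (V c) a (w c) (w′ c)) ⟩
  ∑ (λ c → a * (s c * (V c * w c)) + s c * (V c * w′ c))
    ≡⟨ ∑-distrib-+ (λ c → a * (s c * (V c * w c))) (λ c → s c * (V c * w′ c)) ⟩
  ∑ (λ c → a * (s c * (V c * w c))) + cofactorSum b w′
    ≡⟨ cong (_+ cofactorSum b w′) (sym (*-distribˡ-sum a (λ c → s c * (V c * w c)))) ⟩
  a * cofactorSum b w + cofactorSum b w′ ∎
  where
  s = altSign
  V = λ c → vandermonde (b ∘ punchIn c)
  distrib : ∀ s v a x y → s * (v * (a * x + y)) ≡ a * (s * (v * x)) + s * (v * y)
  distrib = solve-∀

cofactorSum-zero : ∀ {n} (b : Fin (suc n) → ℤ) {w} → (∀ c → w c ≡ 0ℤ) → cofactorSum b w ≡ 0ℤ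
cofactorSum-zero {n} b {w} w≡0 = trans (∑-cong term≡0) (∑-zero (suc n))
  where
  term≡0 : ∀ c → altSign c * (vandermonde (b ∘ punchIn c) * w c) ≡ 0ℤ
  term≡0 c = begin
    altSign c * (vandermonde (b ∘ punchIn c) * w c)  ≡⟨ cong (λ x → altSign c * (vandermonde (b ∘ punchIn c) * x)) (w≡0 c) ⟩
    altSign c * (vandermonde (b ∘ punchIn c) * 0ℤ)   ≡⟨ cong (altSign c *_) (*-zeroʳ (vandermonde (b ∘ punchIn c))) ⟩
    altSign c * 0ℤ                                   ≡⟨ *-zeroʳ (altSign c) ⟩
    0ℤ                                               ∎

vandermonde-expansion : ∀ n (b : Fin (suc n) → ℤ) {t p} → Poly n t p → cofactorSum b (p ∘ b) ≡ t * vandermonde b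
cofactorSum-one : ∀ n (b : Fin (suc (suc n)) → ℤ) → cofactorSum b (λ _ → 1ℤ) ≡ 0ℤ
cofactorSum-root : ∀ n (b : Fin (suc (suc n)) → ℤ) {t q} → Poly n t q →
  cofactorSum b (λ c → (b c - b zero) * q (b c)) ≡ t * vandermonde b

vandermonde-expansion zero b {t} {p} (const p≡t) = begin
  1ℤ * (1ℤ * p (b zero)) + 0ℤ  ≡⟨ cong (λ x → 1ℤ * (1ℤ * x) + 0ℤ) (p≡t (b zero)) ⟩
  1ℤ * (1ℤ * t) + 0ℤ           ≡⟨ simplify t ⟩
  t * 1ℤ                       ∎
  where simplify : ∀ t → 1ℤ * (1ℤ * t) + 0ℤ ≡ t * 1ℤ
        simplify = solve-∀
vandermonde-expansion (suc n) b {t} {p} P with poly-factor P (b zero)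
... | q , Q , p-factor = begin
  cofactorSum b (p ∘ b)
    ≡⟨ cofactorSum-cong b (λ c → trans (p-factor (b c)) (cong (_+ (b c - β) * q (b c)) (sym (*-identityʳ (p β))))) ⟩
  cofactorSum b (λ c → p β * 1ℤ + (b c - β) * q (b c))
    ≡⟨ cofactorSum-linear b (p β) (λ _ → 1ℤ) (λ c → (b c - β) * q (b c)) ⟩
  p β * cofactorSum b (λ _ → 1ℤ) + cofactorSum b (λ c → (b c - β) * q (b c))
    ≡⟨ cong₂ (λ u v → p β * u + v) (cofactorSum-one n b) (cofactorSum-root n b Q) ⟩
  p β * 0ℤ + t * vandermonde b
    ≡⟨ cong (_+ t * vandermonde b) (*-zeroʳ (p β)) ⟩
  0ℤ + t * vandermonde b
    ≡⟨ +-identityˡ (t * vandermonde b) ⟩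
  t * vandermonde b ∎
  where β = b zero

-- The minors of the rows c ≥ 1 factor through those of b ∘ suc, with the factor given by rootQuotient.
cofactorSum-one n b = begin
  1ℤ * (V b′ * 1ℤ) + ∑ (λ c → altSign (suc c) * (V (b ∘ punchIn (suc c)) * 1ℤ))
    ≡⟨ cong (λ x → 1ℤ * (V b′ * 1ℤ) + x) (∑-cong term) ⟩
  1ℤ * (V b′ * 1ℤ) + ∑ (λ c → - 1ℤ * (altSign c * (V (b′ ∘ punchIn c) * r (b′ c))))
    ≡⟨ cong (λ x → 1ℤ * (V b′ * 1ℤ) + x) (sym (*-distribˡ-sum (- 1ℤ) (λ c → altSign c * (V (b′ ∘ punchIn c) * r (b′ c))))) ⟩
  1ℤ * (V b′ * 1ℤ) + - 1ℤ * cofactorSum b′ (r ∘ b′)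
    ≡⟨ cong (λ x → 1ℤ * (V b′ * 1ℤ) + - 1ℤ * x) (vandermonde-expansion n b′ (poly-rootQuotient b′ β)) ⟩
  1ℤ * (V b′ * 1ℤ) + - 1ℤ * (1ℤ * V b′)
    ≡⟨ cancel (V b′) ⟩
  0ℤ ∎
  where
  β  = b zero
  b′ = b ∘ suc
  V  = vandermonde
  r  = rootQuotient b′ β
  cancel : ∀ v → 1ℤ * (v * 1ℤ) + - 1ℤ * (1ℤ * v) ≡ 0ℤ
  cancel = solve-∀
  reorder : ∀ s r v → - 1ℤ * s * ((r * v) * 1ℤ) ≡ - 1ℤ * (s * (v * r))
  reorder = solve-∀
  term : ∀ c → altSign (suc c) * (V (b ∘ punchIn (suc c)) * 1ℤ) ≡ - 1ℤ * (altSign c * (V (b′ ∘ punchIn c) * r (b′ c)))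
  term c = begin
    - 1ℤ * altSign c * ((∏ (λ j → β - b′ (punchIn c j)) * V (b′ ∘ punchIn c)) * 1ℤ)
      ≡⟨ cong (λ x → - 1ℤ * altSign c * ((x * V (b′ ∘ punchIn c)) * 1ℤ)) (sym (rootQuotient-root b′ β c)) ⟩
    - 1ℤ * altSign c * ((r (b′ c) * V (b′ ∘ punchIn c)) * 1ℤ)
      ≡⟨ reorder (altSign c) (r (b′ c)) (V (b′ ∘ punchIn c)) ⟩
    - 1ℤ * (altSign c * (V (b′ ∘ punchIn c) * r (b′ c))) ∎

cofactorSum-root n b {t} {q} Q = begin
  1ℤ * (V b′ * ((β - β) * q β)) + ∑ (λ c → altSign (suc c) * (V (b ∘ punchIn (suc c)) * ((b′ c - β) * q (b′ c))))
    ≡⟨ cong₂ _+_ (vanish (V b′) β (q β)) (∑-cong term) ⟩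
  0ℤ + ∑ (λ c → Π * (altSign c * (V (b′ ∘ punchIn c) * q (b′ c))))
    ≡⟨ +-identityˡ (∑ (λ c → Π * (altSign c * (V (b′ ∘ punchIn c) * q (b′ c))))) ⟩
  ∑ (λ c → Π * (altSign c * (V (b′ ∘ punchIn c) * q (b′ c))))
    ≡⟨ sym (*-distribˡ-sum Π (λ c → altSign c * (V (b′ ∘ punchIn c) * q (b′ c)))) ⟩
  Π * cofactorSum b′ (q ∘ b′)
    ≡⟨ cong (Π *_) (vandermonde-expansion n b′ Q) ⟩
  Π * (t * V b′)
    ≡⟨ swap Π t (V b′) ⟩
  t * (Π * V b′) ∎
  where
  β  = b zero
  b′ = b ∘ suc
  V  = vandermonde
  Π  = ∏ (λ j → β - b′ j)
  vanish : ∀ v β q → 1ℤ * (v * ((β - β) * q)) ≡ 0ℤ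
  vanish = solve-∀
  swap : ∀ a b c → a * (b * c) ≡ b * (a * c)
  swap = solve-∀
  reorder : ∀ s a v x β q → - 1ℤ * s * ((a * v) * ((x - β) * q)) ≡ ((β - x) * a) * (s * (v * q))
  reorder = solve-∀
  term : ∀ c → altSign (suc c) * (V (b ∘ punchIn (suc c)) * ((b′ c - β) * q (b′ c)))
             ≡ Π * (altSign c * (V (b′ ∘ punchIn c) * q (b′ c)))
  term c = begin
    - 1ℤ * altSign c * ((∏ (λ j → β - b′ (punchIn c j)) * V (b′ ∘ punchIn c)) * ((b′ c - β) * q (b′ c)))
      ≡⟨ reorder (altSign c) (∏ (λ j → β - b′ (punchIn c j))) (V (b′ ∘ punchIn c)) (b′ c) β (q (b′ c)) ⟩
    ((β - b′ c) * ∏ (λ j → β - b′ (punchIn c j))) * (altSign c * (V (b′ ∘ punchIn c) * q (b′ c)))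
      ≡⟨ cong (_* (altSign c * (V (b′ ∘ punchIn c) * q (b′ c)))) (sym (∏-remove {n} {c} (λ j → β - b′ j))) ⟩
    Π * (altSign c * (V (b′ ∘ punchIn c) * q (b′ c))) ∎

sumTo : ℕ → (ℕ → ℤ) → ℤ
sumTo zero    F = 0ℤ
sumTo (suc N) F = sumTo N F + F (suc N)

sumTo-cong : ∀ N {F G : ℕ → ℤ} → (∀ z → F z ≡ G z) → sumTo N F ≡ sumTo N G
sumTo-cong zero    F≗G = refl
sumTo-cong (suc N) F≗G = cong₂ _+_ (sumTo-cong N F≗G) (F≗G (suc N))

sumTo-zero : ∀ N {F : ℕ → ℤ} → (∀ z → F z ≡ 0ℤ) → sumTo N F ≡ 0ℤ
sumTo-zero zero    F≡0 = refl
sumTo-zero (suc N) F≡0 = trans (cong₂ _+_ (sumTo-zero N F≡0) (F≡0 (suc N))) (+-identityʳ 0ℤ)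

sumTo-linear : ∀ N a (F G : ℕ → ℤ) → sumTo N (λ z → a * F z + G z) ≡ a * sumTo N F + sumTo N G
sumTo-linear zero    a F G = sym (trans (cong (_+ 0ℤ) (*-zeroʳ a)) (+-identityʳ 0ℤ))
sumTo-linear (suc N) a F G = begin
  sumTo N (λ z → a * F z + G z) + (a * F (suc N) + G (suc N))
    ≡⟨ cong (_+ (a * F (suc N) + G (suc N))) (sumTo-linear N a F G) ⟩
  (a * sumTo N F + sumTo N G) + (a * F (suc N) + G (suc N))
    ≡⟨ regroup a (sumTo N F) (sumTo N G) (F (suc N)) (G (suc N)) ⟩
  a * (sumTo N F + F (suc N)) + (sumTo N G + G (suc N)) ∎
  where regroup : ∀ a u v f g → (a * u + v) + (a * f + g) ≡ a * (u + f) + (v + g)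
        regroup = solve-∀

*-distribˡ-sumTo : ∀ N a (F : ℕ → ℤ) → a * sumTo N F ≡ sumTo N (λ z → a * F z)
*-distribˡ-sumTo zero    a F = *-zeroʳ a
*-distribˡ-sumTo (suc N) a F =
  trans (*-distribˡ-+ a (sumTo N F) (F (suc N))) (cong (_+ a * F (suc N)) (*-distribˡ-sumTo N a F))

+-sumFrom1 : ∀ N (F : ℕ → ℕ) → + sumFrom1 N F ≡ sumTo N (λ z → + F z)
+-sumFrom1 zero    F = refl
+-sumFrom1 (suc N) F = trans (pos-+ (sumFrom1 N F) (F (suc N))) (cong (_+ + F (suc N)) (+-sumFrom1 N F))

∑fun-sumTo : ∀ n k N (F : (Fin n → Fin k) → ℕ → ℤ) →
  ∑fun n k (λ f → sumTo N (F f)) ≡ sumTo N (λ z → ∑fun n k (λ f → F f z))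
∑fun-sumTo n k zero    F = ∑fun-zero n k
∑fun-sumTo n k (suc N) F =
  trans (∑fun-distrib-+ n k (λ f → sumTo N (F f)) (λ f → F f (suc N)))
        (cong (_+ ∑fun n k (λ f → F f (suc N))) (∑fun-sumTo n k N F))

pos-^ : ∀ y k → + (y ℕ.^ k) ≡ (+ y) ^ k
pos-^ y zero    = refl
pos-^ y (suc k) = trans (pos-* y (y ℕ.^ k)) (cong (+ y *_) (pos-^ y k))

powerDifference : ℕ → ℤ → ℤ
powerDifference k x = x ^ suc k - (x - 1ℤ) ^ suc k

poly-powerDifference : ∀ k → Poly k (+ suc k) (powerDifference k)
poly-powerDifference zero = const (λ x → difference x)
  where difference : ∀ x → x * 1ℤ - (x - 1ℤ) * 1ℤ ≡ 1ℤ
        difference = solve-∀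
poly-powerDifference (suc k) =
  subst (λ u → Poly (suc k) u (powerDifference (suc k))) (trans (sym (pos-+ (suc k) 1)) (cong +_ (ℕ.+-comm (suc k) 1)))
    (poly-resp (poly-+ (poly-mulLinear 1ℤ (poly-powerDifference k)) (poly-pow (suc k)))
               (λ x → recurrence x (x ^ suc k) ((x - 1ℤ) ^ suc k)))
  where recurrence : ∀ x a b → (x - 1ℤ) * (a - b) + a ≡ x * a - (x - 1ℤ) * b
        recurrence = solve-∀

sumTo-powerDifference : ∀ k N → sumTo N (λ z → powerDifference k (+ z)) ≡ (+ N) ^ suc k
sumTo-powerDifference k zero    = sym (*-zeroˡ ((+ 0) ^ k))
sumTo-powerDifference k (suc N) = begin
  sumTo N (λ z → powerDifference k (+ z)) + powerDifference k (+ suc N)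
    ≡⟨ cong (_+ powerDifference k (+ suc N)) (sumTo-powerDifference k N) ⟩
  (+ N) ^ suc k + ((+ suc N) ^ suc k - (+ suc N - 1ℤ) ^ suc k)
    ≡⟨ cong (λ x → (+ N) ^ suc k + ((+ suc N) ^ suc k - x ^ suc k)) pred≡ ⟩
  (+ N) ^ suc k + ((+ suc N) ^ suc k - (+ N) ^ suc k)
    ≡⟨ cancel ((+ N) ^ suc k) ((+ suc N) ^ suc k) ⟩
  (+ suc N) ^ suc k ∎
  where
  cancel : ∀ a b → a + (b - a) ≡ b
  cancel = solve-∀
  pred≡ : + suc N - 1ℤ ≡ + N
  pred≡ = trans (cong (_- 1ℤ) (pos-+ 1 N)) (cancel-one (+ N))
    where cancel-one : ∀ n → (1ℤ + n) - 1ℤ ≡ n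
          cancel-one = solve-∀

alternatingH : ∀ n → ℕ → (Fin n → ℕ) → ℤ
alternatingH n y b = ∑fun n n (λ τ → signature τ * + hAux y (List.tabulate (b ∘ τ)))

hAux-tabulate-ext : ∀ {n} y (b : Fin n → ℕ) → Extensional (λ (σ : Fin n → Fin n) → + hAux y (List.tabulate (b ∘ σ)))
hAux-tabulate-ext y b σ≗τ = cong (λ l → + hAux y l) (List.tabulate-cong (λ i → cong b (σ≗τ i)))

alternatingH-suc : ∀ n y (b : Fin (suc n) → ℕ) →
  alternatingH (suc n) y b ≡ ∑ (λ c → altSign c * sumTo (b c ℕ.* y) (λ z → alternatingH n z (b ∘ punchIn c)))
alternatingH-suc n y b = begin
  alternatingH (suc n) y b
    ≡⟨ laplace n (λ σ → + hAux y (List.tabulate (b ∘ σ))) (hAux-tabulate-ext y b) ⟩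
  ∑ (λ c → altSign c * ∑fun n n (λ τ → signature τ * + sumFrom1 (b c ℕ.* y) (H c τ)))
    ≡⟨ ∑-cong (λ c → cong (altSign c *_) (expand c)) ⟩
  ∑ (λ c → altSign c * sumTo (b c ℕ.* y) (λ z → alternatingH n z (b ∘ punchIn c))) ∎
  where
  H : Fin (suc n) → (Fin n → Fin n) → ℕ → ℕ
  H c τ z = hAux z (List.tabulate (b ∘ punchIn c ∘ τ))
  expand : ∀ c → ∑fun n n (λ τ → signature τ * + sumFrom1 (b c ℕ.* y) (H c τ))
                 ≡ sumTo (b c ℕ.* y) (λ z → alternatingH n z (b ∘ punchIn c))
  expand c = begin
    ∑fun n n (λ τ → signature τ * + sumFrom1 N (H c τ))
      ≡⟨ ∑fun-cong n n (λ τ → trans (cong (signature τ *_) (+-sumFrom1 N (H c τ)))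
                                     (*-distribˡ-sumTo N (signature τ) (λ z → + H c τ z))) ⟩
    ∑fun n n (λ τ → sumTo N (λ z → signature τ * + H c τ z))
      ≡⟨ ∑fun-sumTo n n N (λ τ z → signature τ * + H c τ z) ⟩
    sumTo N (λ z → alternatingH n z (b ∘ punchIn c)) ∎
    where N = b c ℕ.* y

sumPoly : (ℤ → ℤ) → ℕ → ℤ
sumPoly p N = sumTo N (λ z → p (+ z))

-- Φ F is what remains of (n + 1)! · alternatingH (suc n) y b once the minors are evaluated by induction,
-- with F N = (n + 1) · Σ_{z=1}^{N} z ^ n.
module AlternatingEvaluation (n : ℕ) (b : Fin (suc n) → ℕ) (y : ℕ) where

  B : Fin (suc n) → ℤ
  B i = + b i

  Φ : (ℕ → ℤ) → ℤ
  Φ F = cofactorSum B (λ c → ∏ (B ∘ punchIn c) * F (b c ℕ.* y))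

  Φ-cong : ∀ {F G} → (∀ N → F N ≡ G N) → Φ F ≡ Φ G
  Φ-cong F≗G = cofactorSum-cong B (λ c → cong (∏ (B ∘ punchIn c) *_) (F≗G (b c ℕ.* y)))

  Φ-linear : ∀ a F G → Φ (λ N → a * F N + G N) ≡ a * Φ F + Φ G
  Φ-linear a F G = trans (cofactorSum-cong B (λ c → distrib (∏ (B ∘ punchIn c)) a (F (b c ℕ.* y)) (G (b c ℕ.* y))))
                         (cofactorSum-linear B a (λ c → ∏ (B ∘ punchIn c) * F (b c ℕ.* y))
                                                 (λ c → ∏ (B ∘ punchIn c) * G (b c ℕ.* y)))
    where distrib : ∀ p a f g → p * (a * f + g) ≡ a * (p * f) + p * g
          distrib = solve-∀

  Φ-zero : ∀ {F} → (∀ N → F N ≡ 0ℤ) → Φ F ≡ 0ℤ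
  Φ-zero F≡0 = cofactorSum-zero B (λ c → trans (cong (∏ (B ∘ punchIn c) *_) (F≡0 (b c ℕ.* y))) (*-zeroʳ (∏ (B ∘ punchIn c))))

  *-distribˡ-Φ : ∀ a F → a * Φ F ≡ Φ (λ N → a * F N)
  *-distribˡ-Φ a F = begin
    a * Φ F                       ≡⟨ sym (+-identityʳ (a * Φ F)) ⟩
    a * Φ F + 0ℤ                  ≡⟨ cong (λ x → a * Φ F + x) (sym (Φ-zero (λ _ → refl))) ⟩
    a * Φ F + Φ (λ _ → 0ℤ)        ≡⟨ sym (Φ-linear a F (λ _ → 0ℤ)) ⟩
    Φ (λ N → a * F N + 0ℤ)        ≡⟨ Φ-cong (λ N → +-identityʳ (a * F N)) ⟩
    Φ (λ N → a * F N)             ∎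

  pow : ℕ → ℕ → ℤ
  pow k N = (+ N) ^ suc k

  Φ-pow : ∀ k → Φ (pow k) ≡ (∏ B * + y) * cofactorSum B (λ c → (B c * + y) ^ k)
  Φ-pow k = begin
    Φ (pow k)
      ≡⟨ ∑-cong term ⟩
    ∑ (λ c → (∏ B * + y) * (altSign c * (vandermonde (B ∘ punchIn c) * (B c * + y) ^ k)))
      ≡⟨ sym (*-distribˡ-sum (∏ B * + y) (λ c → altSign c * (vandermonde (B ∘ punchIn c) * (B c * + y) ^ k))) ⟩
    (∏ B * + y) * cofactorSum B (λ c → (B c * + y) ^ k) ∎
    where
    reorder : ∀ s v p bc y w → s * (v * (p * ((bc * y) * w))) ≡ ((bc * p) * y) * (s * (v * w))
    reorder = solve-∀
    term : ∀ c → altSign c * (vandermonde (B ∘ punchIn c) * (∏ (B ∘ punchIn c) * pow k (b c ℕ.* y)))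
               ≡ (∏ B * + y) * (altSign c * (vandermonde (B ∘ punchIn c) * (B c * + y) ^ k))
    term c = begin
      altSign c * (V * (P * (+ (b c ℕ.* y)) ^ suc k))
        ≡⟨ cong (λ x → altSign c * (V * (P * x ^ suc k))) (pos-* (b c) y) ⟩
      altSign c * (V * (P * (B c * + y) ^ suc k))
        ≡⟨ reorder (altSign c) V P (B c) (+ y) ((B c * + y) ^ k) ⟩
      ((B c * P) * + y) * (altSign c * (V * (B c * + y) ^ k))
        ≡⟨ cong (λ x → (x * + y) * (altSign c * (V * (B c * + y) ^ k))) (sym (∏-remove {n} {c} B)) ⟩
      (∏ B * + y) * (altSign c * (V * (B c * + y) ^ k)) ∎
      where V = vandermonde (B ∘ punchIn c)
            P = ∏ (B ∘ punchIn c)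

  Φ-pow-below : ∀ k → k < n → Φ (pow k) ≡ 0ℤ
  Φ-pow-below k k<n = begin
    Φ (pow k)                                              ≡⟨ Φ-pow k ⟩
    (∏ B * + y) * cofactorSum B (λ c → (B c * + y) ^ k)    ≡⟨ cong ((∏ B * + y) *_) (vandermonde-expansion n B P) ⟩
    (∏ B * + y) * (0ℤ * vandermonde B)                     ≡⟨ cong ((∏ B * + y) *_) (*-zeroˡ (vandermonde B)) ⟩
    (∏ B * + y) * 0ℤ                                       ≡⟨ *-zeroʳ (∏ B * + y) ⟩
    0ℤ                                                     ∎
    where P = poly-raise k<n (poly-dilate (poly-pow k) (+ y))

  Φ-pow-top : Φ (pow n) ≡ (∏ B * + y) * ((1ℤ * (+ y) ^ n) * vandermonde B)
  Φ-pow-top = trans (Φ-pow n) (cong ((∏ B * + y) *_) (vandermonde-expansion n B (poly-dilate (poly-pow n) (+ y))))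

  Φ-sumTo       : ∀ k {t p} → Poly k t p → k ≤ n → + suc k * Φ (sumPoly p) ≡ t * Φ (pow k)
  Φ-sumTo-lower : ∀ k {r} → Poly k 0ℤ r → k ≤ n → Φ (sumPoly r) ≡ 0ℤ

  Φ-sumTo-lower zero    (const r≡0) _ = Φ-zero (λ N → sumTo-zero N (λ z → r≡0 (+ z)))
  Φ-sumTo-lower (suc k) {r} R k<n with poly-lower R
  ... | u , Q = *-cancelˡ-≡ (+ suc k) (Φ (sumPoly r)) 0ℤ (begin
    + suc k * Φ (sumPoly r)  ≡⟨ Φ-sumTo k Q (ℕ.<⇒≤ k<n) ⟩
    u * Φ (pow k)      ≡⟨ cong (u *_) (Φ-pow-below k k<n) ⟩
    u * 0ℤ             ≡⟨ *-zeroʳ u ⟩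
    0ℤ                 ≡⟨ sym (*-zeroʳ (+ suc k)) ⟩
    + suc k * 0ℤ       ∎)

  Φ-sumTo k {t} {p} P k≤n = begin
    + suc k * Φ (sumPoly p)
      ≡⟨ *-distribˡ-Φ (+ suc k) (sumPoly p) ⟩
    Φ (λ N → + suc k * sumPoly p N)
      ≡⟨ Φ-cong split ⟩
    Φ (λ N → t * sumPoly (powerDifference k) N + sumPoly r N)
      ≡⟨ Φ-linear t (sumPoly (powerDifference k)) (sumPoly r) ⟩
    t * Φ (sumPoly (powerDifference k)) + Φ (sumPoly r)
      ≡⟨ cong₂ (λ u v → t * u + v) (Φ-cong (sumTo-powerDifference k)) (Φ-sumTo-lower k R k≤n) ⟩
    t * Φ (pow k) + 0ℤ
      ≡⟨ +-identityʳ (t * Φ (pow k)) ⟩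
    t * Φ (pow k) ∎
    where
    r : ℤ → ℤ
    r x = + suc k * p x + - t * powerDifference k x
    R : Poly k 0ℤ r
    R = subst (λ u → Poly k u r) (cancel (+ suc k) t)
          (poly-+ (poly-scale (+ suc k) P) (poly-scale (- t) (poly-powerDifference k)))
      where cancel : ∀ a t → a * t + - t * a ≡ 0ℤ
            cancel = solve-∀
    decompose : ∀ a t px ex → a * px ≡ t * ex + (a * px + - t * ex)
    decompose = solve-∀
    split : ∀ N → + suc k * sumPoly p N ≡ t * sumPoly (powerDifference k) N + sumPoly r N
    split N = begin
      + suc k * sumPoly p N
        ≡⟨ *-distribˡ-sumTo N (+ suc k) (λ z → p (+ z)) ⟩
      sumTo N (λ z → + suc k * p (+ z))
        ≡⟨ sumTo-cong N (λ z → decompose (+ suc k) t (p (+ z)) (powerDifference k (+ z))) ⟩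
      sumTo N (λ z → t * powerDifference k (+ z) + r (+ z))
        ≡⟨ sumTo-linear N t (λ z → powerDifference k (+ z)) (λ z → r (+ z)) ⟩
      t * sumPoly (powerDifference k) N + sumPoly r N ∎

  factorial-alternatingH-suc :
    (∀ z c → + (n !) * alternatingH n z (b ∘ punchIn c) ≡ + (z ℕ.^ n) * ∏ (B ∘ punchIn c) * vandermonde (B ∘ punchIn c)) →
    + (suc n !) * alternatingH (suc n) y b ≡ Φ (λ N → + suc n * sumPoly (_^ n) N)
  factorial-alternatingH-suc formula = begin
    + (suc n !) * alternatingH (suc n) y b
      ≡⟨ cong₂ _*_ (pos-* (suc n) (n !)) (alternatingH-suc n y b) ⟩
    (+ suc n * + (n !)) * ∑ (λ c → altSign c * K c)
      ≡⟨ *-distribˡ-sum (+ suc n * + (n !)) (λ c → altSign c * K c) ⟩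
    ∑ (λ c → (+ suc n * + (n !)) * (altSign c * K c))
      ≡⟨ ∑-cong term ⟩
    Φ (λ N → + suc n * sumPoly (_^ n) N) ∎
    where
    N = λ c → b c ℕ.* y
    P = λ c → ∏ (B ∘ punchIn c)
    V = λ c → vandermonde (B ∘ punchIn c)
    K = λ c → sumTo (N c) (λ z → alternatingH n z (b ∘ punchIn c))
    minors : ∀ c → + (n !) * K c ≡ (P c * V c) * sumPoly (_^ n) (N c)
    minors c = begin
      + (n !) * K c
        ≡⟨ *-distribˡ-sumTo (N c) (+ (n !)) (λ z → alternatingH n z (b ∘ punchIn c)) ⟩
      sumTo (N c) (λ z → + (n !) * alternatingH n z (b ∘ punchIn c))
        ≡⟨ sumTo-cong (N c) (λ z → trans (formula z c)
                                         (trans (cong (λ x → x * P c * V c) (pos-^ z n)) (rotate ((+ z) ^ n) (P c) (V c)))) ⟩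
      sumTo (N c) (λ z → (P c * V c) * (+ z) ^ n)
        ≡⟨ sym (*-distribˡ-sumTo (N c) (P c * V c) (λ z → (+ z) ^ n)) ⟩
      (P c * V c) * sumPoly (_^ n) (N c) ∎
      where rotate : ∀ x p v → x * p * v ≡ (p * v) * x
            rotate = solve-∀
    term : ∀ c → (+ suc n * + (n !)) * (altSign c * K c) ≡ altSign c * (V c * (P c * (+ suc n * sumPoly (_^ n) (N c))))
    term c = begin
      (+ suc n * + (n !)) * (altSign c * K c)
        ≡⟨ shuffle (+ suc n) (+ (n !)) (altSign c) (K c) ⟩
      altSign c * (+ suc n * (+ (n !) * K c))
        ≡⟨ cong (λ x → altSign c * (+ suc n * x)) (minors c) ⟩
      altSign c * (+ suc n * ((P c * V c) * sumPoly (_^ n) (N c)))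
        ≡⟨ cong (altSign c *_) (regroup (+ suc n) (P c) (V c) (sumPoly (_^ n) (N c))) ⟩
      altSign c * (V c * (P c * (+ suc n * sumPoly (_^ n) (N c)))) ∎
      where shuffle : ∀ a f s x → (a * f) * (s * x) ≡ s * (a * (f * x))
            shuffle = solve-∀
            regroup : ∀ a p v x → a * ((p * v) * x) ≡ v * (p * (a * x))
            regroup = solve-∀

alternatingH-formula : ∀ n y (b : Fin n → ℕ) →
  + (n !) * alternatingH n y b ≡ + (y ℕ.^ n) * ∏ (λ i → + b i) * vandermonde (λ i → + b i)
alternatingH-formula zero    y b = refl
alternatingH-formula (suc n) y b = begin
  + (suc n !) * alternatingH (suc n) y b
    ≡⟨ factorial-alternatingH-suc (λ z c → alternatingH-formula n z (b ∘ punchIn c)) ⟩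
  Φ (λ N → + suc n * sumPoly (_^ n) N)
    ≡⟨ sym (*-distribˡ-Φ (+ suc n) (sumPoly (_^ n))) ⟩
  + suc n * Φ (sumPoly (_^ n))
    ≡⟨ Φ-sumTo n (poly-pow n) ℕ.≤-refl ⟩
  1ℤ * Φ (pow n)
    ≡⟨ cong (1ℤ *_) Φ-pow-top ⟩
  1ℤ * ((∏ B * + y) * ((1ℤ * (+ y) ^ n) * vandermonde B))
    ≡⟨ reorder (∏ B) (+ y) ((+ y) ^ n) (vandermonde B) ⟩
  (+ y * (+ y) ^ n) * ∏ B * vandermonde B
    ≡⟨ cong (λ x → x * ∏ B * vandermonde B) (sym (pos-^ y (suc n))) ⟩
  + (y ℕ.^ suc n) * ∏ B * vandermonde B ∎
  where
  open AlternatingEvaluation n b y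
  reorder : ∀ p y yⁿ v → 1ℤ * ((p * y) * ((1ℤ * yⁿ) * v)) ≡ (y * yⁿ) * p * v
  reorder = solve-∀

module _ {n : ℕ} (σ : Fin n → Fin n) where

  pairSigns : List (Fin n × Fin n) → ℤ
  pairSigns L = prodℤ (map (λ p → pairSign (σ (proj₁ p)) (σ (proj₂ p))) L)

  Separated : Fin n × Fin n → Set
  Separated p = ¬ σ (proj₁ p) ≡ σ (proj₂ p)

  pairSigns-separated : ∀ L → All Separated L →
    pairSigns L ≡ (- 1ℤ) ^ List.length (filter (λ p → σ (proj₂ p) Fin.<? σ (proj₁ p)) L)
  pairSigns-separated List.[] All.[] = refl
  -- does (σ j Fin.<? σ i) computes to this boolean.
  pairSigns-separated ((i , j) List.∷ L) (σi≢σj All.∷ separated) with toℕ (σ j) ℕ.<ᵇ toℕ (σ i)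
  ... | true  = cong (- 1ℤ *_) (pairSigns-separated L separated)
  ... | false with σ i Fin.≟ σ j
  ...   | yes σi≡σj = ⊥-elim (σi≢σj σi≡σj)
  ...   | no  _     = trans (*-identityˡ (pairSigns L)) (pairSigns-separated L separated)

  pairSigns-collision : ∀ L → ¬ All Separated L → pairSigns L ≡ 0ℤ
  pairSigns-collision List.[]              ¬separated = ⊥-elim (¬separated All.[])
  pairSigns-collision ((i , j) List.∷ L) ¬separated = split (σ i Fin.≟ σ j)
    where
    split : Dec (σ i ≡ σ j) → pairSign (σ i) (σ j) * pairSigns L ≡ 0ℤ
    split (yes σi≡σj) = begin
      pairSign (σ i) (σ j) * pairSigns L  ≡⟨ cong (λ x → pairSign x (σ j) * pairSigns L) σi≡σj ⟩
      pairSign (σ j) (σ j) * pairSigns L  ≡⟨ cong (_* pairSigns L) (pairSign-refl (σ j)) ⟩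
      0ℤ * pairSigns L                    ≡⟨ *-zeroˡ (pairSigns L) ⟩
      0ℤ                                  ∎
    split (no σi≢σj) = begin
      pairSign (σ i) (σ j) * pairSigns L  ≡⟨ cong (pairSign (σ i) (σ j) *_) (pairSigns-collision L (¬separated ∘ (σi≢σj All.∷_))) ⟩
      pairSign (σ i) (σ j) * 0ℤ           ≡⟨ *-zeroʳ (pairSign (σ i) (σ j)) ⟩
      0ℤ                                  ∎

sumℤ-perms : ∀ n (X : (Fin n → Fin n) → ℤ) →
  sumℤ (map (λ σ → sign σ * X σ) (perms n)) ≡ sumℤ (map (λ σ → signature σ * X σ) (allFuns n n))
sumℤ-perms n X = go (allFuns n n)
  where
  separated? : ∀ σ → Dec (All (Separated σ) (pairs n))
  separated? σ = all? (λ p → ¬? (σ (proj₁ p) Fin.≟ σ (proj₂ p))) (pairs n)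
  go : ∀ L → sumℤ (map (λ σ → sign σ * X σ) (filter separated? L)) ≡ sumℤ (map (λ σ → signature σ * X σ) L)
  go List.[] = refl
  go (σ List.∷ L) with separated? σ
  ... | yes separated = cong₂ _+_ (cong (_* X σ) sign≡signature) (go L)
    where sign≡signature : sign σ ≡ signature σ
          sign≡signature = trans (sym (pairSigns-separated σ (pairs n) separated))
                                 (prodℤ-pairs n (λ i j → pairSign (σ i) (σ j)))
  ... | no ¬separated = begin
    sumℤ (map (λ σ → sign σ * X σ) (filter separated? L))    ≡⟨ go L ⟩
    sumℤ (map (λ σ → signature σ * X σ) L)                   ≡⟨ sym (+-identityˡ (sumℤ (map (λ σ → signature σ * X σ) L))) ⟩
    0ℤ + sumℤ (map (λ σ → signature σ * X σ) L)              ≡⟨ cong (_+ sumℤ (map (λ σ → signature σ * X σ) L)) (sym signature≡0) ⟩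
    signature σ * X σ + sumℤ (map (λ σ → signature σ * X σ) L) ∎
    where signature≡0 : signature σ * X σ ≡ 0ℤ
          signature≡0 = begin
            signature σ * X σ    ≡⟨ cong (_* X σ) (sym (prodℤ-pairs n (λ i j → pairSign (σ i) (σ j)))) ⟩
            pairSigns σ (pairs n) * X σ  ≡⟨ cong (_* X σ) (pairSigns-collision σ (pairs n) ¬separated) ⟩
            0ℤ * X σ             ≡⟨ *-zeroˡ (X σ) ⟩
            0ℤ                   ∎

h-permArgs : ∀ {n} m (a : Fin n → ℕ) σ → h (permArgs m a σ) ≡ hAux m (List.tabulate (a ∘ σ))
h-permArgs {zero}  m a σ = refl
h-permArgs {suc n} m a σ =
  cong (λ N → sumFrom1 N (λ y → hAux y (List.tabulate (λ i → a (σ (suc i))))))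
       (trans (ℕ.*-identityʳ (m ℕ.* a (σ zero))) (ℕ.*-comm m (a (σ zero))))

𝓗≡alternatingH : ∀ n m (a : Fin n → ℕ) → 𝓗 m a ≡ alternatingH n m a
𝓗≡alternatingH n m a = begin
  𝓗 m a
    ≡⟨ sumℤ-perms n (λ σ → + h (permArgs m a σ)) ⟩
  sumℤ (map (λ σ → signature σ * + h (permArgs m a σ)) (allFuns n n))
    ≡⟨ cong sumℤ (List.map-cong (λ σ → cong (λ x → signature σ * + x) (h-permArgs m a σ)) (allFuns n n)) ⟩
  sumℤ (map G (allFuns n n))
    ≡⟨ sumℤ-allFuns n n G (λ σ≗τ → cong₂ _*_ (signature-cong σ≗τ) (hAux-tabulate-ext m a σ≗τ)) ⟩
  alternatingH n m a ∎
  where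
  G : (Fin n → Fin n) → ℤ
  G σ = signature σ * + hAux m (List.tabulate (a ∘ σ))

proposition2p22 : (n m : ℕ) → 1 ≤ m → (a : Fin n → ℕ) →
    + (n !) * 𝓗 m a ≡
      + (m ℕ.^ n) * prodℤ (map (λ i → + a i) (allFin n))
        * prodℤ (map (λ p → + a (proj₁ p) - + a (proj₂ p)) (pairs n))
proposition2p22 n m _ a = begin
  + (n !) * 𝓗 m a
    ≡⟨ cong (+ (n !) *_) (𝓗≡alternatingH n m a) ⟩
  + (n !) * alternatingH n m a
    ≡⟨ alternatingH-formula n m a ⟩
  + (m ℕ.^ n) * ∏ A * vandermonde A
    ≡⟨ cong₂ (λ u v → + (m ℕ.^ n) * u * v) (sym (prodℤ-allFin A)) (sym (prodℤ-pairs n (λ i j → A i - A j))) ⟩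
  + (m ℕ.^ n) * prodℤ (map A (allFin n)) * prodℤ (map (λ p → A (proj₁ p) - A (proj₂ p)) (pairs n)) ∎
  where
  A : Fin n → ℤ
  A i = + a i
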